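{- Let $R$ be a p.q.-Baer $*$-ring. If $\Gamma^*_s(R)$ contains a vertex adjacent to all the other vertices, then $|CP(R)|=4$.
   Context: A $*$-ring is a ring $R$ with an involution $x\mapsto x^*$. A projection is an element $e$ with $e^2=e=e^*$; a central projection is a projection in the centre of $R$; $CP(R)$ is the set of central projections. For $S\subseteq R$, $r_R(S)=\{x\in R: sx=0\ \forall s\in S\}$. $R$ is a p.q.-Baer $*$-ring if for every $a\in R$, $r_R(aR)=eR$ for some projection $e\in R$. The strong zero-divisor graph $\Gamma^*_s(R)$ is the simple undirected graph with vertex set $\{0\neq a\in R: r_R(aR)\neq\{0\}\}$, distinct vertices $a,b$ adjacent iff $aRb^*=0$. -}

module Defs where

open import Level using (Level; _⊔_; suc)
open import Algebra.Bundles using (Ring)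
open import Data.Product using (Σ; ∃; _×_; _,_)
open import Data.Sum using (_⊎_)
open import Relation.Nullary using (¬_)
open import Function.Bundles using (_⇔_)

record StarRing (c ℓ : Level) : Set (suc (c ⊔ ℓ)) where
  field
    ring : Ring c ℓ
  open Ring ring public
  field
    _⋆       : Carrier → Carrier
    ⋆-cong   : ∀ {x y} → x ≈ y → (x ⋆) ≈ (y ⋆)
    ⋆-+      : ∀ x y → ((x + y) ⋆) ≈ ((x ⋆) + (y ⋆))
    ⋆-*      : ∀ x y → ((x * y) ⋆) ≈ ((y ⋆) * (x ⋆))
    ⋆-invol  : ∀ x → ((x ⋆) ⋆) ≈ x

module _ {c ℓ : Level} (R : StarRing c ℓ) where
  open StarRing R

  IsProjection : Carrier → Set ℓ
  IsProjection e = (e * e ≈ e) × ((e ⋆) ≈ e)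

  IsCentral : Carrier → Set (c ⊔ ℓ)
  IsCentral e = ∀ x → e * x ≈ x * e

  IsCentralProjection : Carrier → Set (c ⊔ ℓ)
  IsCentralProjection e = IsProjection e × IsCentral e

  InRightAnnOfPrincipal : Carrier → Carrier → Set (c ⊔ ℓ)
  InRightAnnOfPrincipal a x = ∀ r → (a * r) * x ≈ 0#

  InRightIdeal : Carrier → Carrier → Set (c ⊔ ℓ)
  InRightIdeal e x = ∃ λ y → x ≈ e * y

  IsPQBaer : Set (c ⊔ ℓ)
  IsPQBaer = ∀ a → ∃ λ e → IsProjection e ×
               (∀ x → InRightAnnOfPrincipal a x ⇔ InRightIdeal e x)

  -- vertex of the strong zero-divisor graph: a ≠ 0 and r_R(aR) ≠ {0}
  -- (r_R(aR) ≠ {0} read as: r_R(aR) contains a nonzero element)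
  IsVertex : Carrier → Set (c ⊔ ℓ)
  IsVertex a = ¬ (a ≈ 0#) × ∃ λ x → ¬ (x ≈ 0#) × InRightAnnOfPrincipal a x

  Adjacent : Carrier → Carrier → Set (c ⊔ ℓ)
  Adjacent a b = IsVertex a × IsVertex b × ¬ (a ≈ b) × (∀ r → (a * r) * (b ⋆) ≈ 0#)

  HasUniversalVertex : Set (c ⊔ ℓ)
  HasUniversalVertex = ∃ λ v → IsVertex v × (∀ w → IsVertex w → ¬ (w ≈ v) → Adjacent v w)

  CPHasFourElements : Set (c ⊔ ℓ)
  CPHasFourElements =
    Σ Carrier λ e₁ → Σ Carrier λ e₂ → Σ Carrier λ e₃ → Σ Carrier λ e₄ →
      IsCentralProjection e₁ × IsCentralProjection e₂ ×
      IsCentralProjection e₃ × IsCentralProjection e₄ ×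
      ¬ (e₁ ≈ e₂) × ¬ (e₁ ≈ e₃) × ¬ (e₁ ≈ e₄) ×
      ¬ (e₂ ≈ e₃) × ¬ (e₂ ≈ e₄) × ¬ (e₃ ≈ e₄) ×
      (∀ e → IsCentralProjection e → (e ≈ e₁) ⊎ (e ≈ e₂) ⊎ (e ≈ e₃) ⊎ (e ≈ e₄))

-- Let v be the universal vertex and e the projection with r(vR) = eR.  Since r(vR) is a
-- two-sided ideal, s e = e s e for all s, and applying * shows that e is central.  It is
-- neither 0 (v has a nonzero right annihilator) nor 1 (v ≠ 0), so 0, 1, e, 1 - e are four
-- distinct central projections.  A central projection f ∉ {0, 1} makes f and 1 - f vertices
-- (f (1 - f) = 0).  If neither equals v, both are adjacent to v, i.e. f*, (1 - f)* ∈ r(vR),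
-- so f e = f and (1 - f) e = 1 - f, whence e = 1.  Otherwise v is f or 1 - f, and as
-- r(fR) = (1 - f)R for a central projection f, e is 1 - f or f respectively.

{-# OPTIONS --safe #-}
module Submission where

open import Defs
open import Level using (Level; _⊔_; Lift; lift; lower)
open import Axiom.ExcludedMiddle using (ExcludedMiddle)
open import Algebra.Bundles using (Ring)
open import Data.Empty using (⊥-elim)
open import Data.Product using (∃; _×_; _,_; proj₁; proj₂)
open import Data.Sum using (_⊎_; inj₁; inj₂)
open import Function.Base using (_∘_)
open import Function.Bundles using (_⇔_; Equivalence)
open import Relation.Nullary using (¬_; Dec; yes; no)
open import Relation.Nullary.Decidable using (map′)
import Algebra.Properties.Ring as RingProperties
import Relation.Binary.Reasoning.Setoid as ≈-Reasoning

module ComplementProperties {c ℓ} (R : Ring c ℓ) where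
  open Ring R
  open RingProperties R
  open ≈-Reasoning setoid

  x+[1-x]≈1 : ∀ x → x + (1# - x) ≈ 1#
  x+[1-x]≈1 x = trans (+-comm x (1# - x)) (//-rightDividesˡ x 1#)

  1-[1-x]≈x : ∀ x → 1# - (1# - x) ≈ x
  1-[1-x]≈x x = begin
    1# - (1# - x)   ≈⟨ +-congˡ (⁻¹-anti-homo‿- 1# x) ⟩
    1# + (x - 1#)   ≈⟨ +-assoc 1# x (- 1#) ⟨
    (1# + x) - 1#   ≈⟨ +-congʳ (+-comm 1# x) ⟩
    (x + 1#) - 1#   ≈⟨ //-rightDividesʳ 1# x ⟩
    x               ∎

  1-‿cong : ∀ {x y} → x ≈ y → 1# - x ≈ 1# - y
  1-‿cong = +-congˡ ∘ -‿cong

  1-x≈0⇒x≈1 : ∀ {x} → 1# - x ≈ 0# → x ≈ 1#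
  1-x≈0⇒x≈1 {x} = sym ∘ x∙y⁻¹≈ε⇒x≈y 1# x

  1-x≈1⇒x≈0 : ∀ {x} → 1# - x ≈ 1# → x ≈ 0#
  1-x≈1⇒x≈0 {x} 1-x≈1 = begin
    x               ≈⟨ 1-[1-x]≈x x ⟨
    1# - (1# - x)   ≈⟨ 1-‿cong 1-x≈1 ⟩
    1# - 1#         ≈⟨ -‿inverseʳ 1# ⟩
    0#              ∎

  0≈1⇒x≈0 : ∀ x → 0# ≈ 1# → x ≈ 0#
  0≈1⇒x≈0 x 0≈1 = begin
    x        ≈⟨ *-identityʳ x ⟨
    x * 1#   ≈⟨ *-congˡ 0≈1 ⟨
    x * 0#   ≈⟨ zeroʳ x ⟩
    0#       ∎

  module _ {p : Carrier} (pp≈p : p * p ≈ p) where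

    idempotent⇒p[1-p]≈0 : p * (1# - p) ≈ 0#
    idempotent⇒p[1-p]≈0 =
      trans (x[y-z]≈xy-xz p 1# p) (x≈y⇒x∙y⁻¹≈ε (trans (*-identityʳ p) (sym pp≈p)))

    idempotent⇒[1-p]-idempotent : (1# - p) * (1# - p) ≈ 1# - p
    idempotent⇒[1-p]-idempotent = begin
      (1# - p) * (1# - p)            ≈⟨ [y-z]x≈yx-zx (1# - p) 1# p ⟩
      1# * (1# - p) - p * (1# - p)   ≈⟨ //-cong₂ (*-identityˡ (1# - p)) idempotent⇒p[1-p]≈0 ⟩
      (1# - p) - 0#                  ≈⟨ +-congˡ -0#≈0# ⟩
      (1# - p) + 0#                  ≈⟨ +-identityʳ (1# - p) ⟩
      1# - p                         ∎

    idempotent-≈1-p⇒≈0 : p ≈ 1# - p → p ≈ 0#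
    idempotent-≈1-p⇒≈0 p≈1-p = begin
      p              ≈⟨ pp≈p ⟨
      p * p          ≈⟨ *-congˡ p≈1-p ⟩
      p * (1# - p)   ≈⟨ idempotent⇒p[1-p]≈0 ⟩
      0#             ∎

  x*e≈x⇒[1-x]*e≈1-x⇒e≈1 : ∀ {x e} → x * e ≈ x → (1# - x) * e ≈ 1# - x → e ≈ 1#
  x*e≈x⇒[1-x]*e≈1-x⇒e≈1 {x} {e} xe≈x [1-x]e≈1-x = begin
    e                          ≈⟨ *-identityˡ e ⟨
    1# * e                     ≈⟨ *-congʳ (x+[1-x]≈1 x) ⟨
    (x + (1# - x)) * e         ≈⟨ distribʳ e x (1# - x) ⟩
    x * e + (1# - x) * e       ≈⟨ +-cong xe≈x [1-x]e≈1-x ⟩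
    x + (1# - x)               ≈⟨ x+[1-x]≈1 x ⟩
    1#                         ∎

module StarRingProperties {c ℓ} (R : StarRing c ℓ) where
  open StarRing R
  open RingProperties ring
  open ComplementProperties ring
  open ≈-Reasoning setoid

  ⋆-0# : 0# ⋆ ≈ 0#
  ⋆-0# = x+x≈x⇒x≈0 (0# ⋆) (sym (trans (⋆-cong (sym (+-identityʳ 0#))) (⋆-+ 0# 0#)))

  ⋆-1# : 1# ⋆ ≈ 1#
  ⋆-1# = begin
    1# ⋆                 ≈⟨ *-identityʳ (1# ⋆) ⟨
    1# ⋆ * 1#            ≈⟨ *-congˡ (⋆-invol 1#) ⟨
    1# ⋆ * (1# ⋆) ⋆      ≈⟨ ⋆-* (1# ⋆) 1# ⟨
    (1# ⋆ * 1#) ⋆        ≈⟨ ⋆-cong (*-identityʳ (1# ⋆)) ⟩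
    (1# ⋆) ⋆             ≈⟨ ⋆-invol 1# ⟩
    1#                   ∎

  ⋆-‿ : ∀ x → (- x) ⋆ ≈ - (x ⋆)
  ⋆-‿ x = +-inverseʳ-unique (x ⋆) ((- x) ⋆) (begin
    x ⋆ + (- x) ⋆   ≈⟨ ⋆-+ x (- x) ⟨
    (x - x) ⋆       ≈⟨ ⋆-cong (-‿inverseʳ x) ⟩
    0# ⋆            ≈⟨ ⋆-0# ⟩
    0#              ∎)

  ⋆-1- : ∀ x → (1# - x) ⋆ ≈ 1# - x ⋆
  ⋆-1- x = trans (⋆-+ 1# (- x)) (+-cong ⋆-1# (⋆-‿ x))

  ⋆-*-⋆ˡ : ∀ x y → (x ⋆ * y) ⋆ ≈ y ⋆ * x
  ⋆-*-⋆ˡ x y = trans (⋆-* (x ⋆) y) (*-congˡ (⋆-invol x))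

  0#-isCentralProjection : IsCentralProjection R 0#
  0#-isCentralProjection = (zeroˡ 0# , ⋆-0#) , λ x → trans (zeroˡ x) (sym (zeroʳ x))

  1#-isCentralProjection : IsCentralProjection R 1#
  1#-isCentralProjection = (*-identityˡ 1# , ⋆-1#) , λ x → trans (*-identityˡ x) (sym (*-identityʳ x))

  1-‿isCentralProjection : ∀ {p} → IsCentralProjection R p → IsCentralProjection R (1# - p)
  1-‿isCentralProjection {p} ((pp≈p , p⋆≈p) , p-central) =
    (idempotent⇒[1-p]-idempotent pp≈p , trans (⋆-1- p) (1-‿cong p⋆≈p)) , [1-p]-central
    where
    [1-p]-central : IsCentral R (1# - p)
    [1-p]-central x = begin
      (1# - p) * x     ≈⟨ [y-z]x≈yx-zx x 1# p ⟩
      1# * x - p * x   ≈⟨ //-cong₂ (trans (*-identityˡ x) (sym (*-identityʳ x))) (p-central x) ⟩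
      x * 1# - x * p   ≈⟨ x[y-z]≈xy-xz x 1# p ⟨
      x * (1# - p)     ∎

  centralProjection-annihilates-1-p :
    ∀ {p} → IsCentralProjection R p → InRightAnnOfPrincipal R p (1# - p)
  centralProjection-annihilates-1-p {p} ((pp≈p , _) , p-central) r = begin
    p * r * (1# - p)     ≈⟨ *-congʳ (p-central r) ⟩
    r * p * (1# - p)     ≈⟨ *-assoc r p (1# - p) ⟩
    r * (p * (1# - p))   ≈⟨ *-congˡ (idempotent⇒p[1-p]≈0 pp≈p) ⟩
    r * 0#               ≈⟨ zeroʳ r ⟩
    0#                   ∎

  centralProjection⇒vertex :
    ∀ {p} → IsCentralProjection R p → ¬ p ≈ 0# → ¬ p ≈ 1# → IsVertex R p
  centralProjection⇒vertex p-cp p≉0 p≉1 =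
    p≉0 , _ , p≉1 ∘ 1-x≈0⇒x≈1 , centralProjection-annihilates-1-p p-cp

module AnnihilatorProjection {c ℓ} (R : StarRing c ℓ) {a e : StarRing.Carrier R}
  (e-projection : IsProjection R e)
  (r[aR]≈eR : ∀ x → InRightAnnOfPrincipal R a x ⇔ InRightIdeal R e x) where
  open StarRing R
  open ComplementProperties ring
  open StarRingProperties R
  open ≈-Reasoning setoid

  private
    ee≈e : e * e ≈ e
    ee≈e = proj₁ e-projection

    e⋆≈e : e ⋆ ≈ e
    e⋆≈e = proj₂ e-projection

  annihilator⇒fixed : ∀ {x} → InRightAnnOfPrincipal R a x → e * x ≈ x
  annihilator⇒fixed {x} x∈r[aR] =
    let (y , x≈ey) = Equivalence.to (r[aR]≈eR x) x∈r[aR] in begin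
      e * x         ≈⟨ *-congˡ x≈ey ⟩
      e * (e * y)   ≈⟨ *-assoc e e y ⟨
      e * e * y     ≈⟨ *-congʳ ee≈e ⟩
      e * y         ≈⟨ x≈ey ⟨
      x             ∎

  e-annihilator : InRightAnnOfPrincipal R a e
  e-annihilator = Equivalence.from (r[aR]≈eR e) (e , sym ee≈e)

  annihilator-leftIdeal :
    ∀ {x} → InRightAnnOfPrincipal R a x → ∀ s → InRightAnnOfPrincipal R a (s * x)
  annihilator-leftIdeal {x} x∈r[aR] s r = begin
    a * r * (s * x)     ≈⟨ *-assoc (a * r) s x ⟨
    a * r * s * x       ≈⟨ *-congʳ (*-assoc a r s) ⟩
    a * (r * s) * x     ≈⟨ x∈r[aR] (r * s) ⟩
    0#                  ∎

  e-central : IsCentral R e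
  e-central s = begin
    e * s                    ≈⟨ trans (⋆-*-⋆ˡ s e) (*-congʳ e⋆≈e) ⟨
    (s ⋆ * e) ⋆              ≈⟨ ⋆-cong (se≈ese (s ⋆)) ⟨
    (e * (s ⋆ * e)) ⋆        ≈⟨ ⋆-* e (s ⋆ * e) ⟩
    (s ⋆ * e) ⋆ * e ⋆        ≈⟨ *-cong (⋆-*-⋆ˡ s e) e⋆≈e ⟩
    e ⋆ * s * e              ≈⟨ *-congʳ (*-congʳ e⋆≈e) ⟩
    e * s * e                ≈⟨ *-assoc e s e ⟩
    e * (s * e)              ≈⟨ se≈ese s ⟩
    s * e                    ∎
    where
    se≈ese : ∀ s → e * (s * e) ≈ s * e
    se≈ese s = annihilator⇒fixed (annihilator-leftIdeal e-annihilator s)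

  e-isCentralProjection : IsCentralProjection R e
  e-isCentralProjection = e-projection , e-central

  a≉0⇒e≉1 : ¬ a ≈ 0# → ¬ e ≈ 1#
  a≉0⇒e≉1 a≉0 e≈1 = a≉0 (begin
    a             ≈⟨ *-identityʳ a ⟨
    a * 1#        ≈⟨ *-identityʳ (a * 1#) ⟨
    a * 1# * 1#   ≈⟨ *-congˡ e≈1 ⟨
    a * 1# * e    ≈⟨ e-annihilator 1# ⟩
    0#            ∎)

  nonzeroAnnihilator⇒e≉0 : (∃ λ x → ¬ x ≈ 0# × InRightAnnOfPrincipal R a x) → ¬ e ≈ 0#
  nonzeroAnnihilator⇒e≉0 (x , x≉0 , x∈r[aR]) e≈0 = x≉0 (begin
    x        ≈⟨ annihilator⇒fixed x∈r[aR] ⟨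
    e * x    ≈⟨ *-congʳ e≈0 ⟩
    0# * x   ≈⟨ zeroˡ x ⟩
    0#       ∎)

  ⋆-annihilator⇒fixedʳ : ∀ {w} → InRightAnnOfPrincipal R a (w ⋆) → w * e ≈ w
  ⋆-annihilator⇒fixedʳ {w} w⋆∈r[aR] = begin
    w * e              ≈⟨ *-cong (⋆-invol w) e⋆≈e ⟨
    (w ⋆) ⋆ * e ⋆      ≈⟨ ⋆-* e (w ⋆) ⟨
    (e * w ⋆) ⋆        ≈⟨ ⋆-cong (annihilator⇒fixed w⋆∈r[aR]) ⟩
    (w ⋆) ⋆            ≈⟨ ⋆-invol w ⟩
    w                  ∎

  centralProjection-annihilator : ∀ {f} → IsCentralProjection R f → f ≈ a → e ≈ 1# - f
  centralProjection-annihilator {f} f-cp f≈a = begin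
    e                          ≈⟨ *-identityʳ e ⟨
    e * 1#                     ≈⟨ *-congˡ (x+[1-x]≈1 f) ⟨
    e * (f + (1# - f))         ≈⟨ distribˡ e f (1# - f) ⟩
    e * f + e * (1# - f)       ≈⟨ +-cong (trans (e-central f) fe≈0) (annihilator⇒fixed [1-f]∈r[aR]) ⟩
    0# + (1# - f)              ≈⟨ +-identityˡ (1# - f) ⟩
    1# - f                     ∎
    where
    fe≈0 : f * e ≈ 0#
    fe≈0 = trans (*-congʳ (trans f≈a (sym (*-identityʳ a)))) (e-annihilator 1#)
    [1-f]∈r[aR] : InRightAnnOfPrincipal R a (1# - f)
    [1-f]∈r[aR] r = trans (*-congʳ (*-congʳ (sym f≈a))) (centralProjection-annihilates-1-p f-cp r)

module UniversalVertex {c ℓ} (R : StarRing c ℓ) {v e : StarRing.Carrier R}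
  (e-projection : IsProjection R e)
  (r[vR]≈eR : ∀ x → InRightAnnOfPrincipal R v x ⇔ InRightIdeal R e x)
  (v-universal : ∀ w → IsVertex R w → ¬ StarRing._≈_ R w v → Adjacent R v w) where
  open StarRing R
  open ComplementProperties ring
  open StarRingProperties R
  open AnnihilatorProjection R e-projection r[vR]≈eR

  vertex≉v⇒fixedʳ : ∀ {w} → IsVertex R w → ¬ w ≈ v → w * e ≈ w
  vertex≉v⇒fixedʳ {w} w-vertex w≉v =
    let (_ , _ , _ , vRw⋆≈0) = v-universal w w-vertex w≉v in ⋆-annihilator⇒fixedʳ vRw⋆≈0

  centralProjection≈v⇒≈1-e : ∀ {f} → IsCentralProjection R f → f ≈ v → f ≈ 1# - e
  centralProjection≈v⇒≈1-e {f} f-cp f≈v =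
    trans (sym (1-[1-x]≈x f)) (1-‿cong (sym (centralProjection-annihilator f-cp f≈v)))

  1-centralProjection≈v⇒≈e : ∀ {f} → IsCentralProjection R f → 1# - f ≈ v → f ≈ e
  1-centralProjection≈v⇒≈e {f} f-cp 1-f≈v =
    trans (sym (1-[1-x]≈x f))
          (sym (centralProjection-annihilator (1-‿isCentralProjection f-cp) 1-f≈v))

  nontrivialCentralProjection≉v⇒e≈1 : ∀ {f} → IsCentralProjection R f →
    ¬ f ≈ 0# → ¬ f ≈ 1# → ¬ f ≈ v → ¬ 1# - f ≈ v → e ≈ 1#
  nontrivialCentralProjection≉v⇒e≈1 {f} f-cp f≉0 f≉1 f≉v 1-f≉v = x*e≈x⇒[1-x]*e≈1-x⇒e≈1
    (vertex≉v⇒fixedʳ (centralProjection⇒vertex f-cp f≉0 f≉1) f≉v)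
    (vertex≉v⇒fixedʳ [1-f]-vertex 1-f≉v)
    where
    [1-f]-vertex : IsVertex R (1# - f)
    [1-f]-vertex = centralProjection⇒vertex (1-‿isCentralProjection f-cp)
      (f≉1 ∘ 1-x≈0⇒x≈1) (f≉0 ∘ 1-x≈1⇒x≈0)

  centralProjection-classification : ExcludedMiddle (c ⊔ ℓ) → ¬ e ≈ 1# →
    ∀ f → IsCentralProjection R f → f ≈ 0# ⊎ f ≈ 1# ⊎ f ≈ e ⊎ f ≈ 1# - e
  centralProjection-classification em e≉1 f f-cp
    with ≈-dec f 0# | ≈-dec f 1# | ≈-dec f v | ≈-dec (1# - f) v
    where
    ≈-dec : ∀ x y → Dec (x ≈ y)
    ≈-dec x y = map′ lower lift (em {Lift c (x ≈ y)})
  ... | yes f≈0 | _       | _       | _         = inj₁ f≈0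
  ... | no _    | yes f≈1 | _       | _         = inj₂ (inj₁ f≈1)
  ... | no _    | no _    | _       | yes 1-f≈v = inj₂ (inj₂ (inj₁ (1-centralProjection≈v⇒≈e f-cp 1-f≈v)))
  ... | no _    | no _    | yes f≈v | no _      = inj₂ (inj₂ (inj₂ (centralProjection≈v⇒≈1-e f-cp f≈v)))
  ... | no f≉0  | no f≉1  | no f≉v  | no 1-f≉v  =
    ⊥-elim (e≉1 (nontrivialCentralProjection≉v⇒e≈1 f-cp f≉0 f≉1 f≉v 1-f≉v))

corollary4p8 : ∀ {c ℓ : Level} → ExcludedMiddle (c ⊔ ℓ) → (R : StarRing c ℓ) →
    IsPQBaer R → HasUniversalVertex R → CPHasFourElements R
corollary4p8 em R pq (v , v-vertex , v-universal) with pq v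
... | e , e-projection , r[vR]≈eR =
  0# , 1# , e , 1# - e ,
  0#-isCentralProjection , 1#-isCentralProjection ,
  e-isCentralProjection , 1-‿isCentralProjection e-isCentralProjection ,
  e≉0 ∘ 0≈1⇒x≈0 e , e≉0 ∘ sym , e≉1 ∘ 1-x≈0⇒x≈1 ∘ sym ,
  e≉1 ∘ sym , e≉0 ∘ 1-x≈1⇒x≈0 ∘ sym , e≉0 ∘ idempotent-≈1-p⇒≈0 (proj₁ e-projection) ,
  centralProjection-classification em e≉1
  where
  open StarRing R
  open ComplementProperties ring
  open StarRingProperties R
  open AnnihilatorProjection R e-projection r[vR]≈eR
  open UniversalVertex R e-projection r[vR]≈eR v-universal

  e≉0 : ¬ e ≈ 0#
  e≉0 = nonzeroAnnihilator⇒e≉0 (proj₂ v-vertex)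

  e≉1 : ¬ e ≈ 1#
  e≉1 = a≉0⇒e≉1 (proj₁ v-vertex)
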